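{- Suppose $(D,\leq_D,\ll_D)$ is a set with two partial orders $\leq_D$ and $\ll_D$ such that $\ll_D$ is coarser than $\leq_D$. If $(E,\leq_E)$ is a poset extending $(D,\leq_D)$, then there is a partial order $\ll_E$ on $E$ such that $\ll_E$ is coarser than $\leq_E$ and $(E,\leq_E,\ll_E)$ extends $(D,\leq_D,\ll_D)$.
   Context: A relation $\ll$ is coarser than $\leq$ if $x\leq y$ implies $x\ll y$. "$(E,\leq_E)$ extends $(D,\leq_D)$" means $D\subseteq E$ and $\leq_E$ restricted to $D$ equals $\leq_D$; similarly for structures with two relations (both restrictions agree). -}

module Defs where

open import Level using (Level)
open import Relation.Binary.Core using (Rel; _⇒_)
open import Relation.Binary.PropositionalEquality using (_≡_)
open import Function.Bundles using (_⇔_)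

Coarser : ∀ {a ℓ₁ ℓ₂} {A : Set a} → Rel A ℓ₁ → Rel A ℓ₂ → Set _
Coarser _≪_ _≤_ = _≤_ ⇒ _≪_

RestrictsTo : ∀ {a b ℓ₁ ℓ₂} {D : Set a} {E : Set b} → (D → E) →
              Rel E ℓ₁ → Rel D ℓ₂ → Set _
RestrictsTo ι R S = ∀ x y → (R (ι x) (ι y) ⇔ S x y)

-- Extend ≪ to E by x ≪ y iff x ≤ y or x ≤ ι d ≪ ι d' ≤ y for some d, d' in D.
-- Any ≪E-relation between two points of D already holds in ≪D: the two ≤E-legs
-- lie between points of D, hence in ≤D, hence in ≪D. So if x ≪E y and y ≪E x,
-- a detour through D in either direction closes a ≪D-cycle, which collapses the
-- detour and leaves x ≤E y; antisymmetry of ≤E finishes.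
module Submission where

open import Defs
open import Level using (_⊔_)
open import Relation.Binary.Core using (Rel)
open import Relation.Binary.Structures using (IsPartialOrder)
open import Relation.Binary.PropositionalEquality using (_≡_; refl; subst; isEquivalence)
open import Function.Definitions using (Injective)
open import Function.Bundles using (mk⇔; Equivalence)
open import Data.Product using (Σ-syntax; _×_; _,_)
open import Data.Sum using (_⊎_; inj₁; inj₂)

module Extension
  {a b ℓ₁ ℓ₂} {D : Set a} {E : Set b} (ι : D → E)
  {_≪D_ : Rel D ℓ₁} (≪D-isPartialOrder : IsPartialOrder _≡_ _≪D_)
  {_≤E_ : Rel E ℓ₂} (≤E-isPartialOrder : IsPartialOrder _≡_ _≤E_)
  (≤E⇒≪D : ∀ {d e} → ι d ≤E ι e → d ≪D e)
  where

  private
    module ≪D = IsPartialOrder ≪D-isPartialOrder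
    module ≤E = IsPartialOrder ≤E-isPartialOrder

  record Detour (x y : E) : Set (a ⊔ ℓ₁ ⊔ ℓ₂) where
    constructor detour
    field
      {entry exit} : D
      x≤entry : x ≤E ι entry
      entry≪exit : entry ≪D exit
      exit≤y : ι exit ≤E y

  _≪E_ : Rel E (a ⊔ ℓ₁ ⊔ ℓ₂)
  x ≪E y = x ≤E y ⊎ Detour x y

  ≪E-trans : ∀ {x y z} → x ≪E y → y ≪E z → x ≪E z
  ≪E-trans (inj₁ x≤y) (inj₁ y≤z) = inj₁ (≤E.trans x≤y y≤z)
  ≪E-trans (inj₁ x≤y) (inj₂ (detour y≤d d≪d′ d′≤z)) =
    inj₂ (detour (≤E.trans x≤y y≤d) d≪d′ d′≤z)
  ≪E-trans (inj₂ (detour x≤d d≪d′ d′≤y)) (inj₁ y≤z) =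
    inj₂ (detour x≤d d≪d′ (≤E.trans d′≤y y≤z))
  ≪E-trans (inj₂ (detour x≤d d≪d′ d′≤y)) (inj₂ (detour y≤e e≪e′ e′≤z)) =
    inj₂ (detour x≤d (≪D.trans d≪d′ (≪D.trans (≤E⇒≪D (≤E.trans d′≤y y≤e)) e≪e′)) e′≤z)

  ≪E-restricts-to-≪D : ∀ {d e} → ι d ≪E ι e → d ≪D e
  ≪E-restricts-to-≪D (inj₁ d≤e) = ≤E⇒≪D d≤e
  ≪E-restricts-to-≪D (inj₂ (detour d≤f f≪f′ f′≤e)) =
    ≪D.trans (≤E⇒≪D d≤f) (≪D.trans f≪f′ (≤E⇒≪D f′≤e))

  detour-collapses : ∀ {x y} → Detour x y → y ≪E x → x ≤E y
  detour-collapses {x} {y} (detour {d} {d′} x≤d d≪d′ d′≤y) y≪x =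
    ≤E.trans (subst (λ f → x ≤E ι f) d≡d′ x≤d) d′≤y
    where
    d′≪d : d′ ≪D d
    d′≪d = ≪E-restricts-to-≪D (≪E-trans (inj₁ d′≤y) (≪E-trans y≪x (inj₁ x≤d)))

    d≡d′ : d ≡ d′
    d≡d′ = ≪D.antisym d≪d′ d′≪d

  ≪E-antisym : ∀ {x y} → x ≪E y → y ≪E x → x ≡ y
  ≪E-antisym x≪y y≪x = ≤E.antisym (≤E-of x≪y y≪x) (≤E-of y≪x x≪y)
    where
    ≤E-of : ∀ {x y} → x ≪E y → y ≪E x → x ≤E y
    ≤E-of (inj₁ x≤y) _ = x≤y
    ≤E-of (inj₂ x↝y) y≪x = detour-collapses x↝y y≪x

  ≪E-isPartialOrder : IsPartialOrder _≡_ _≪E_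
  ≪E-isPartialOrder = record
    { isPreorder = record
      { isEquivalence = isEquivalence
      ; reflexive = λ { refl → inj₁ ≤E.refl }
      ; trans = ≪E-trans
      }
    ; antisym = ≪E-antisym
    }

  ≪E-restriction : RestrictsTo ι _≪E_ _≪D_
  ≪E-restriction d e =
    mk⇔ ≪E-restricts-to-≪D (λ d≪e → inj₂ (detour ≤E.refl d≪e ≤E.refl))

lemma2p1 : ∀ {a ℓ} (D E : Set a) (ι : D → E) → Injective _≡_ _≡_ ι →
    (_≤D_ _≪D_ : Rel D ℓ) →
    IsPartialOrder _≡_ _≤D_ → IsPartialOrder _≡_ _≪D_ → Coarser _≪D_ _≤D_ →
    (_≤E_ : Rel E ℓ) → IsPartialOrder _≡_ _≤E_ → RestrictsTo ι _≤E_ _≤D_ →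
    Σ[ _≪E_ ∈ Rel E (a ⊔ ℓ) ]
    (IsPartialOrder _≡_ _≪E_ × Coarser _≪E_ _≤E_ × RestrictsTo ι _≪E_ _≪D_)
lemma2p1 D E ι _ _≤D_ _≪D_ _ ≪D-po ≪D-coarser _≤E_ ≤E-po ≤E-restriction =
  _≪E_ , ≪E-isPartialOrder , inj₁ , ≪E-restriction
  where
  ≤E⇒≪D : ∀ {d e} → ι d ≤E ι e → d ≪D e
  ≤E⇒≪D {d} {e} p = ≪D-coarser (Equivalence.to (≤E-restriction d e) p)

  open Extension ι ≪D-po ≤E-po ≤E⇒≪D
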